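{- Let $n\ge2$ and $P=[2]\times[n]$. Under rowmotion on $\mathcal{IC}(P)$ there is at least one orbit of size $\frac{n+3}{3}$ when $n$ is divisible by $3$, and there are at least $\frac{n-1}{2}$ orbits of size $\frac{n+3}{2}$ when $n$ is odd.
   Context: $[2]\times[n]=\{(i,j): i\in\{1,2\},1\le j\le n\}$ with the componentwise order. An interval-closed set (ICS) is a subset $I$ with $x,y\in I$, $x\le z\le y\Rightarrow z\in I$; $\mathcal{IC}(P)$ is the set of ICS. The toggle $t_x$ sends $I$ to $I\triangle\{x\}$ if this is an ICS, and to $I$ otherwise; rowmotion is $\mathrm{Row}=t_{x_1}\circ\cdots\circ t_{x_N}$ for any linear extension $x_1,\dots,x_N$ (toggles applied top to bottom). -}

module Defs where

open import Data.Bool using (Bool; true; false; not)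
open import Data.Bool.Properties using () renaming (_≟_ to _≟ᵇ_)
open import Data.Nat using (ℕ; zero; suc; _≤_; _<_)
open import Data.Fin using (Fin)
import Data.Fin as F
import Data.Fin.Properties as FP
open import Data.Vec using (Vec; lookup; updateAt)
open import Data.List using (List; concatMap; map; allFin; foldr; length)
open import Data.List.Relation.Unary.All using (All)
open import Data.List.Relation.Unary.AllPairs using (AllPairs)
open import Data.Product using (_×_; _,_; proj₁; proj₂; ∃)
open import Relation.Binary.PropositionalEquality using (_≡_; _≢_)
open import Relation.Nullary using (Dec; yes; no; ¬_)
open import Relation.Nullary.Decidable using (_→-dec_; _×-dec_; map′)

-- The poset P = [2] × [n]; element (i , j) stands for (i+1 , j+1).
Elt : ℕ → Set
Elt n = Fin 2 × Fin n

_≤P_ : ∀ {n} → Elt n → Elt n → Set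
(i , j) ≤P (i' , j') = (i F.≤ i') × (j F.≤ j')

SubP : ℕ → Set
SubP n = Vec (Vec Bool n) 2

_∈P_ : ∀ {n} → Elt n → SubP n → Set
(i , j) ∈P I = lookup (lookup I i) j ≡ true

IsICS : ∀ {n} → SubP n → Set
IsICS {n} I = ∀ (x y z : Elt n) → x ∈P I → y ∈P I → x ≤P z → z ≤P y → z ∈P I

private
  allElt? : ∀ {n} {Q : Elt n → Set} → (∀ x → Dec (Q x)) → Dec (∀ x → Q x)
  allElt? {Q = Q} d =
    map′ (λ h x → h (proj₁ x) (proj₂ x)) (λ h i j → h (i , j))
         (FP.all? (λ i → FP.all? (λ j → d (i , j))))

  ∈?  : ∀ {n} (x : Elt n) (I : SubP n) → Dec (x ∈P I)
  ∈? (i , j) I = lookup (lookup I i) j ≟ᵇ true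

  ≤P? : ∀ {n} (x y : Elt n) → Dec (x ≤P y)
  ≤P? (i , j) (i' , j') = (i FP.≤? i') ×-dec (j FP.≤? j')

isICS? : ∀ {n} (I : SubP n) → Dec (IsICS I)
isICS? I = allElt? λ x → allElt? λ y → allElt? λ z →
  ∈? x I →-dec ∈? y I →-dec ≤P? x z →-dec ≤P? z y →-dec ∈? z I

flipP : ∀ {n} → Elt n → SubP n → SubP n
flipP (i , j) I = updateAt I i (λ row → updateAt row j not)

toggle : ∀ {n} → Elt n → SubP n → SubP n
toggle x I with isICS? (flipP x I)
... | yes _ = flipP x I
... | no  _ = I

linExt : (n : ℕ) → List (Elt n)
linExt n = concatMap (λ i → map (λ j → (i , j)) (allFin n)) (allFin 2)

-- Row = t_{x₁} ∘ ⋯ ∘ t_{x_N}  (t_{x_N} applied first, i.e. top to bottom).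
Row : ∀ {n} → SubP n → SubP n
Row {n} I = foldr toggle I (linExt n)

iter : ∀ {A : Set} → (A → A) → ℕ → A → A
iter f zero    x = x
iter f (suc k) x = f (iter f k x)

OrbitSize : ∀ {n} → SubP n → ℕ → Set
OrbitSize I s = (1 ≤ s) × (iter Row s I ≡ I) × (∀ k → 1 ≤ k → k < s → iter Row k I ≢ I)

SameOrbit : ∀ {n} → SubP n → SubP n → Set
SameOrbit I J = ∃ λ k → iter Row k I ≡ J

AtLeastOrbits : ℕ → (n : ℕ) → ℕ → Set
AtLeastOrbits m n s = ∃ λ (L : List (SubP n)) →
  (m ≤ length L) × All (λ I → IsICS I × OrbitSize I s) L
  × AllPairs (λ I J → ¬ SameOrbit I J) L

{-# OPTIONS --safe #-}
-- An interval-closed set of [2] × [n] is a pair of intervals, [a, b) in the lower chain and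
-- [c, d) in the upper one, and toggling one element either moves an endpoint of one of them or
-- would leave a set that is not interval-closed.  So rowmotion acts on the four endpoints, and
-- sweeping each chain from right to left computes it explicitly on the states needed.
--
-- For n = 3K the pair ([K, 2K), [K, 2K)) goes to ([K+1+u, 2K+1+u), [u, u+K)) for u = 0, …, K−1
-- and then back: an orbit of size K + 1.  For n = 2M + 1 and w + v = M − 1 the pair
-- ([v, v+M+1), [v, v+w+1)) runs through M + 2 states; the upper intervals along its orbit have
-- w + 1 or M + 1 elements, so the M choices of w give M different orbits.

module Submission where

open import Defs
open import Data.Bool using (Bool; true; false; not; _xor_; if_then_else_)
open import Data.Empty using (⊥-elim)
open import Data.Fin using (Fin; toℕ; fromℕ<) renaming (zero to fzero; suc to fsuc)
import Data.Fin.Properties as Fin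
open import Data.Maybe using (Maybe; just; nothing; maybe′)
open import Data.Nat
open import Data.Nat.Properties
open import Data.Nat.Tactic.RingSolver using (solve)
open import Data.Product using (_×_; _,_; proj₁; proj₂; ∃)
open import Data.Sum using (_⊎_; inj₁; inj₂)
import Data.Sum as Sum
open import Data.List using (List; []; _∷_; foldr; allFin; upTo; applyUpTo; length)
open import Data.List.Membership.Propositional using (_∈_; _∉_)
open import Data.List.Relation.Unary.Any using (here; there)
import Data.List as List
open import Data.List.Properties
  using (foldr-++; foldr-∷ʳ; ++-identityʳ; upTo-∷ʳ; map-tabulate; length-applyUpTo; length-++)
import Data.List.Relation.Unary.All as All
import Data.List.Relation.Unary.All.Properties as All
import Data.List.Relation.Unary.AllPairs as AllPairs
import Data.List.Relation.Unary.AllPairs.Properties as AllPairs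
open import Data.Nat.DivMod using (m≡m%n+[m/n]*n; m%n<n; m*n/n≡m)
open import Data.Nat.Divisibility using (_∣_; divides; m%n≡0⇒n∣m)
open import Data.Vec using (Vec; _∷_; []; lookup; updateAt; tabulate; map; _[_]≔_)
open import Data.Vec.Properties
  using (lookup∘updateAt; lookup∘updateAt′; lookup∘tabulate; tabulate∘lookup; tabulate-cong)
open import Function using (id; _∘_; _⇔_; mk⇔; case_of_)
open import Relation.Binary.PropositionalEquality
open import Relation.Binary.Definitions using (tri<; tri≈; tri>)
open import Relation.Nullary using (Dec; yes; no; does; ¬_; ¬?; contradiction)
open import Relation.Nullary.Decidable using (_×-dec_; dec-true; dec-false; does-⇔)

variable
  n a b c d j k lo hi : ℕ

Interval : Set
Interval = ℕ × ℕ

infix 4 _∈ᴵ_ _∈ᴵ?_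

_∈ᴵ_ : ℕ → Interval → Set
k ∈ᴵ (lo , hi) = lo ≤ k × k < hi

_∈ᴵ?_ : (k : ℕ) (iv : Interval) → Dec (k ∈ᴵ iv)
k ∈ᴵ? (lo , hi) = lo ≤? k ×-dec k <? hi

member : Interval → ℕ → Bool
member iv k = does (k ∈ᴵ? iv)

dec-true⁻¹ : ∀ {A : Set} (a? : Dec A) → does a? ≡ true → A
dec-true⁻¹ (yes a) _ = a

∈ᴵ-convex : ∀ {iv x y z} → x ∈ᴵ iv → y ∈ᴵ iv → x ≤ z → z ≤ y → z ∈ᴵ iv
∈ᴵ-convex (lo≤x , _) (_ , y<hi) x≤z z≤y = ≤-trans lo≤x x≤z , ≤-<-trans z≤y y<hi

flipped : Interval → ℕ → ℕ → Bool
flipped iv j k = does (k ≟ j) xor member iv k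

module Flipped (iv : Interval) where

  flipped-at : flipped iv j j ≡ not (member iv j)
  flipped-at {j} = cong (_xor member iv j) (dec-true (j ≟ j) refl)

  flipped-off : k ≢ j → flipped iv j k ≡ member iv k
  flipped-off {k} {j} k≢j = cong (_xor member iv k) (dec-false (k ≟ j) k≢j)

  flipped-at-∉ : ¬ j ∈ᴵ iv → flipped iv j j ≡ true
  flipped-at-∉ {j} j∉ = trans flipped-at (cong not (dec-false (j ∈ᴵ? iv) j∉))

  flipped-at-∈ : j ∈ᴵ iv → flipped iv j j ≡ false
  flipped-at-∈ {j} j∈ = trans flipped-at (cong not (dec-true (j ∈ᴵ? iv) j∈))

  flipped-off-∈ : k ≢ j → k ∈ᴵ iv → flipped iv j k ≡ true
  flipped-off-∈ {k} k≢j k∈ = trans (flipped-off k≢j) (dec-true (k ∈ᴵ? iv) k∈)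

  flipped-off-∉ : k ≢ j → ¬ k ∈ᴵ iv → flipped iv j k ≡ false
  flipped-off-∉ {k} k≢j k∉ = trans (flipped-off k≢j) (dec-false (k ∈ᴵ? iv) k∉)

FlipsTo : Interval → ℕ → Interval → Set
FlipsTo iv j iv′ = ∀ k → flipped iv j k ≡ member iv′ k

flipsTo : ∀ {iv iv′} → ((¬ j ∈ᴵ iv) ⇔ j ∈ᴵ iv′) →
          (∀ {k} → k ≢ j → k ∈ᴵ iv ⇔ k ∈ᴵ iv′) → FlipsTo iv j iv′
flipsTo {j} {iv} {iv′} at off k with k ≟ j
... | yes refl = trans (Flipped.flipped-at iv) (does-⇔ at (¬? (k ∈ᴵ? iv)) (k ∈ᴵ? iv′))
... | no k≢j   = trans (Flipped.flipped-off iv k≢j) (does-⇔ (off k≢j) (k ∈ᴵ? iv) (k ∈ᴵ? iv′))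

record Gap (P : ℕ → Bool) (bound : ℕ) : Set where
  field
    {p r s} : ℕ
    p<r     : p < r
    r<s     : r < s
    s<bound : s < bound
    p∈      : P p ≡ true
    r∉      : P r ≡ false
    s∈      : P s ≡ true

FlipSpec : Interval → ℕ → Maybe Interval → Set
FlipSpec iv j (just iv′) = FlipsTo iv j iv′ × proj₂ iv′ ≤ proj₂ iv ⊔ suc j
FlipSpec iv j nothing    = Gap (flipped iv j) (proj₂ iv ⊔ suc j)

flipped-gap : lo < hi → lo ≢ j → suc j ≢ hi → hi ≢ j → suc j ≢ lo →
              Gap (flipped (lo , hi) j) (hi ⊔ suc j)
flipped-gap {lo} {suc h} {j} lo<hi lo≢j sj≢hi hi≢j sj≢lo with <-cmp j lo
... | tri< j<lo _ _ = record
  { p<r = n<1+n j ; r<s = sj<lo ; s<bound = ≤-trans lo<hi (m≤m⊔n (suc h) (suc j))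
  ; p∈ = flipped-at-∉ (λ m → <⇒≱ j<lo (proj₁ m))
  ; r∉ = flipped-off-∉ (>⇒≢ (n<1+n j)) (λ m → <⇒≱ sj<lo (proj₁ m))
  ; s∈ = flipped-off-∈ lo≢j (≤-refl , lo<hi) }
  where open Flipped (lo , suc h)
        sj<lo = ≤∧≢⇒< j<lo sj≢lo
... | tri≈ _ j≡lo _ = ⊥-elim (lo≢j (sym j≡lo))
... | tri> _ _ lo<j with <-cmp j (suc h)
...   | tri< j<hi _ _ = record
  { p<r = lo<j ; r<s = j<h ; s<bound = ≤-trans (n<1+n h) (m≤m⊔n (suc h) (suc j))
  ; p∈ = flipped-off-∈ (<⇒≢ lo<j) (≤-refl , lo<hi)
  ; r∉ = flipped-at-∈ (<⇒≤ lo<j , j<hi)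
  ; s∈ = flipped-off-∈ (>⇒≢ j<h) (<⇒≤ (<-trans lo<j j<h) , n<1+n h) }
  where open Flipped (lo , suc h)
        j<h = ≤-pred (≤∧≢⇒< j<hi sj≢hi)
...   | tri≈ _ j≡hi _ = ⊥-elim (hi≢j (sym j≡hi))
...   | tri> _ _ hi<j = record
  { p<r = n<1+n h ; r<s = hi<j ; s<bound = m≤n⊔m (suc h) (suc j)
  ; p∈ = flipped-off-∈ (<⇒≢ (<-trans (n<1+n h) hi<j)) (≤-pred lo<hi , n<1+n h)
  ; r∉ = flipped-off-∉ hi≢j (λ m → n≮n (suc h) (proj₂ m))
  ; s∈ = flipped-at-∉ (λ m → <⇒≱ (proj₂ m) (<⇒≤ hi<j)) }
  where open Flipped (lo , suc h)

data Away (lo hi j : ℕ) : Set where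
  left   : suc j < lo → Away lo hi j
  inside : lo < j → suc j < hi → Away lo hi j
  right  : hi < j → Away lo hi j

-- Opaque, like toSubP and toggleᴵ below, so that unification sees applications of these
-- functions rather than their normal forms.
opaque
  flipInterval : Interval → ℕ → Maybe Interval
  flipInterval (lo , hi) j =
    if does (hi ≤? lo) then just (j , suc j)
    else if does (lo ≟ j) then just (suc lo , hi)
    else if does (suc j ≟ hi) then just (lo , j)
    else if does (hi ≟ j) then just (lo , suc hi)
    else if does (suc j ≟ lo) then just (j , hi)
    else nothing

  flipInterval-spec : ∀ iv j → FlipSpec iv j (flipInterval iv j)
  flipInterval-spec (lo , hi) j with hi ≤? lo
  ... | yes hi≤lo rewrite dec-true (hi ≤? lo) hi≤lo =
    flipsTo (mk⇔ (λ _ → ≤-refl , ≤-refl) (λ _ m → empty m))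
            (λ k≢j → mk⇔ (⊥-elim ∘ empty)
                         (λ (j≤k , k<sj) → ⊥-elim (k≢j (≤-antisym (≤-pred k<sj) j≤k))))
    , m≤n⊔m hi (suc j)
    where empty : ¬ k ∈ᴵ (lo , hi)
          empty (lo≤k , k<hi) = <⇒≱ (≤-<-trans lo≤k k<hi) hi≤lo
  ... | no hi≰lo rewrite dec-false (hi ≤? lo) hi≰lo with lo ≟ j
  ... | yes refl rewrite dec-true (lo ≟ lo) refl =
    flipsTo (mk⇔ (λ lo∉ → ⊥-elim (lo∉ (≤-refl , ≰⇒> hi≰lo)))
                 (λ m → ⊥-elim (n≮n lo (proj₁ m))))
            (λ k≢lo → mk⇔ (λ (lo≤k , k<hi) → ≤∧≢⇒< lo≤k (k≢lo ∘ sym) , k<hi)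
                          (λ (lo<k , k<hi) → <⇒≤ lo<k , k<hi))
    , m≤m⊔n hi (suc lo)
  ... | no lo≢j rewrite dec-false (lo ≟ j) lo≢j with suc j ≟ hi
  ... | yes refl rewrite dec-true (suc j ≟ suc j) refl =
    flipsTo (mk⇔ (λ j∉ → ⊥-elim (j∉ (≤-pred (≰⇒> hi≰lo) , ≤-refl)))
                 (λ m → ⊥-elim (n≮n j (proj₂ m))))
            (λ k≢j → mk⇔ (λ (lo≤k , k≤j) → lo≤k , ≤∧≢⇒< (≤-pred k≤j) k≢j)
                         (λ (lo≤k , k<j) → lo≤k , m<n⇒m<1+n k<j))
    , ≤-trans (n≤1+n j) (m≤m⊔n (suc j) (suc j))
  ... | no sj≢hi rewrite dec-false (suc j ≟ hi) sj≢hi with hi ≟ j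
  ... | yes refl rewrite dec-true (hi ≟ hi) refl =
    flipsTo (mk⇔ (λ _ → <⇒≤ (≰⇒> hi≰lo) , ≤-refl) (λ m hi∈ → n≮n hi (proj₂ hi∈)))
            (λ k≢hi → mk⇔ (λ (lo≤k , k<hi) → lo≤k , m<n⇒m<1+n k<hi)
                          (λ (lo≤k , k≤hi) → lo≤k , ≤∧≢⇒< (≤-pred k≤hi) k≢hi))
    , m≤n⊔m hi (suc hi)
  ... | no hi≢j rewrite dec-false (hi ≟ j) hi≢j with suc j ≟ lo
  ... | yes refl rewrite dec-true (suc j ≟ suc j) refl =
    flipsTo (mk⇔ (λ _ → ≤-refl , <-trans (n<1+n j) (≰⇒> hi≰lo)) (λ _ m → n≮n j (proj₁ m)))
            (λ k≢j → mk⇔ (λ (sj≤k , k<hi) → <⇒≤ sj≤k , k<hi)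
                         (λ (j≤k , k<hi) → ≤∧≢⇒< j≤k (k≢j ∘ sym) , k<hi))
    , m≤m⊔n hi (suc j)
  ... | no sj≢lo rewrite dec-false (suc j ≟ lo) sj≢lo =
    flipped-gap (≰⇒> hi≰lo) lo≢j sj≢hi hi≢j sj≢lo

  flipInterval-nothing : lo < hi → lo ≢ j → suc j ≢ hi → hi ≢ j → suc j ≢ lo →
                         flipInterval (lo , hi) j ≡ nothing
  flipInterval-nothing {lo} {hi} {j} lo<hi lo≢j sj≢hi hi≢j sj≢lo
    rewrite dec-false (hi ≤? lo) (<⇒≱ lo<hi) | dec-false (lo ≟ j) lo≢j
          | dec-false (suc j ≟ hi) sj≢hi | dec-false (hi ≟ j) hi≢j | dec-false (suc j ≟ lo) sj≢lo = refl

  flipInterval-away : lo < hi → Away lo hi j → flipInterval (lo , hi) j ≡ nothing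
  flipInterval-away {lo} {hi} {j} lo<hi away =
    flipInterval-nothing lo<hi (lo≢j away) (sj≢hi away) (hi≢j away) (sj≢lo away)
    where
    lo≢j : Away lo hi j → lo ≢ j
    lo≢j (left sj<lo)     = >⇒≢ (<-trans (n<1+n j) sj<lo)
    lo≢j (inside lo<j _)  = <⇒≢ lo<j
    lo≢j (right hi<j)     = <⇒≢ (<-trans lo<hi hi<j)
    sj≢hi : Away lo hi j → suc j ≢ hi
    sj≢hi (left sj<lo)    = <⇒≢ (<-trans sj<lo lo<hi)
    sj≢hi (inside _ sj<hi) = <⇒≢ sj<hi
    sj≢hi (right hi<j)    = >⇒≢ (<-trans hi<j (n<1+n j))
    hi≢j : Away lo hi j → hi ≢ j
    hi≢j (left sj<lo)     = >⇒≢ (<-trans (n<1+n j) (<-trans sj<lo lo<hi))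
    hi≢j (inside _ sj<hi) = >⇒≢ (<-trans (n<1+n j) sj<hi)
    hi≢j (right hi<j)     = <⇒≢ hi<j
    sj≢lo : Away lo hi j → suc j ≢ lo
    sj≢lo (left sj<lo)    = <⇒≢ sj<lo
    sj≢lo (inside lo<j _) = >⇒≢ (<-trans lo<j (n<1+n j))
    sj≢lo (right hi<j)    = >⇒≢ (<-trans lo<hi (<-trans hi<j (n<1+n j)))

  flipInterval-empty : hi ≤ lo → flipInterval (lo , hi) j ≡ just (j , suc j)
  flipInterval-empty {hi} {lo} hi≤lo rewrite dec-true (hi ≤? lo) hi≤lo = refl

  flipInterval-removeLo : lo < hi → flipInterval (lo , hi) lo ≡ just (suc lo , hi)
  flipInterval-removeLo {lo} {hi} lo<hi
    rewrite dec-false (hi ≤? lo) (<⇒≱ lo<hi) | dec-true (lo ≟ lo) refl = refl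

  flipInterval-removeHi : lo < j → flipInterval (lo , suc j) j ≡ just (lo , j)
  flipInterval-removeHi {lo} {j} lo<j
    rewrite dec-false (suc j ≤? lo) (<⇒≱ (m<n⇒m<1+n lo<j)) | dec-false (lo ≟ j) (<⇒≢ lo<j)
          | dec-true (suc j ≟ suc j) refl = refl

  flipInterval-addHi : lo < hi → flipInterval (lo , hi) hi ≡ just (lo , suc hi)
  flipInterval-addHi {lo} {hi} lo<hi
    rewrite dec-false (hi ≤? lo) (<⇒≱ lo<hi) | dec-false (lo ≟ hi) (<⇒≢ lo<hi)
          | dec-false (suc hi ≟ hi) (>⇒≢ ≤-refl) | dec-true (hi ≟ hi) refl = refl

  flipInterval-addLo : suc j < hi → flipInterval (suc j , hi) j ≡ just (j , hi)
  flipInterval-addLo {j} {hi} sj<hi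
    rewrite dec-false (hi ≤? suc j) (<⇒≱ sj<hi) | dec-false (suc j ≟ j) (>⇒≢ ≤-refl)
          | dec-false (suc j ≟ hi) (<⇒≢ sj<hi) | dec-false (hi ≟ j) (>⇒≢ (<-trans (n<1+n j) sj<hi))
          | dec-true (suc j ≟ suc j) refl = refl

interval : (n : ℕ) → Interval → Vec Bool n
interval n iv = tabulate (λ k → member iv (toℕ k))

lookup-flip-interval : ∀ iv (j k : Fin n) →
                       lookup (updateAt (interval n iv) j not) k ≡ flipped iv (toℕ j) (toℕ k)
lookup-flip-interval iv j k with k Fin.≟ j
... | yes refl = trans (lookup∘updateAt k (interval _ iv))
                       (trans (cong not (lookup∘tabulate _ k)) (sym (Flipped.flipped-at iv)))
... | no k≢j   = trans (lookup∘updateAt′ k j k≢j (interval _ iv))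
                       (trans (lookup∘tabulate _ k) (sym (Flipped.flipped-off iv (k≢j ∘ Fin.toℕ-injective))))

interval-flip : ∀ {iv iv′} (j : Fin n) → FlipsTo iv (toℕ j) iv′ →
                updateAt (interval n iv) j not ≡ interval n iv′
interval-flip {iv = iv} j flips =
  trans (sym (tabulate∘lookup _)) (tabulate-cong λ k → trans (lookup-flip-interval iv j k) (flips (toℕ k)))

interval-transfer : ∀ {iv iv′} → interval n iv ≡ interval n iv′ → k < n → k ∈ᴵ iv → k ∈ᴵ iv′
interval-transfer {n} {k} {iv} {iv′} eq k<n k∈ =
  subst (_∈ᴵ iv′) (Fin.toℕ-fromℕ< k<n) (dec-true⁻¹ (toℕ f ∈ᴵ? iv′) (begin
    member iv′ (toℕ f)         ≡⟨ lookup∘tabulate _ f ⟨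
    lookup (interval n iv′) f  ≡⟨ cong (λ row → lookup row f) eq ⟨
    lookup (interval n iv) f   ≡⟨ lookup∘tabulate _ f ⟩
    member iv (toℕ f)          ≡⟨ dec-true (toℕ f ∈ᴵ? iv) f∈ ⟩
    true                       ∎))
  where open ≡-Reasoning
        f = fromℕ< k<n
        f∈ = subst (_∈ᴵ iv) (sym (Fin.toℕ-fromℕ< k<n)) k∈

interval-injective : lo < hi → hi ≤ n → ∀ {lo′ hi′} → lo′ < hi′ → hi′ ≤ n →
                     interval n (lo , hi) ≡ interval n (lo′ , hi′) → lo ≡ lo′ × hi ≡ hi′
interval-injective {lo} {suc h} {n} lo<hi hi≤n {lo′} {suc h′} lo′<hi′ hi′≤n eq =
  ≤-antisym (proj₁ (transfer⁻ (<-≤-trans lo′<hi′ hi′≤n) (≤-refl , lo′<hi′)))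
            (proj₁ (transfer (<-≤-trans lo<hi hi≤n) (≤-refl , lo<hi))) ,
  ≤-antisym (proj₂ (transfer hi≤n (≤-pred lo<hi , ≤-refl)))
            (proj₂ (transfer⁻ hi′≤n (≤-pred lo′<hi′ , ≤-refl)))
  where transfer : ∀ {k} → k < n → k ∈ᴵ (lo , suc h) → k ∈ᴵ (lo′ , suc h′)
        transfer = interval-transfer eq
        transfer⁻ : ∀ {k} → k < n → k ∈ᴵ (lo′ , suc h′) → k ∈ᴵ (lo , suc h)
        transfer⁻ = interval-transfer (sym eq)

IntervalPair : Set
IntervalPair = Vec Interval 2

-- quad a b c d = {(1, j+1) : a ≤ j < b} ∪ {(2, j+1) : c ≤ j < d}, in the 0-based coordinates of Defs.
pattern quad a b c d = (a , b) ∷ (c , d) ∷ []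

bottom top : Fin 2
bottom = fzero
top    = fsuc fzero

Bounded : ℕ → IntervalPair → Set
Bounded n (quad a b c d) = b ≤ n × d ≤ n

bounded-lookup : ∀ {p} (i : Fin 2) → Bounded n p → proj₂ (lookup p i) ≤ n
bounded-lookup {p = quad a b c d} fzero        (b≤n , _) = b≤n
bounded-lookup {p = quad a b c d} (fsuc fzero) (_ , d≤n) = d≤n

bounded-update : ∀ {p iv} (i : Fin 2) → Bounded n p → proj₂ iv ≤ n → Bounded n (p [ i ]≔ iv)
bounded-update {p = quad a b c d} fzero        (_ , d≤n) hi≤n = hi≤n , d≤n
bounded-update {p = quad a b c d} (fsuc fzero) (b≤n , _) hi≤n = b≤n , hi≤n

opaque
  toSubP : (n : ℕ) → IntervalPair → SubP n
  toSubP n = map (interval n)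

  lookup-toSubP-row : ∀ p (i : Fin 2) → lookup (toSubP n p) i ≡ interval n (lookup p i)
  lookup-toSubP-row (quad a b c d) fzero        = refl
  lookup-toSubP-row (quad a b c d) (fsuc fzero) = refl

  lookup-toSubP : ∀ p (i : Fin 2) (k : Fin n) →
                  lookup (lookup (toSubP n p) i) k ≡ member (lookup p i) (toℕ k)
  lookup-toSubP (quad a b c d) fzero        k = lookup∘tabulate _ k
  lookup-toSubP (quad a b c d) (fsuc fzero) k = lookup∘tabulate _ k

  flipP-toSubP : ∀ p {iv} (i : Fin 2) (j : Fin n) → FlipsTo (lookup p i) (toℕ j) iv →
                 flipP (i , j) (toSubP n p) ≡ toSubP n (p [ i ]≔ iv)
  flipP-toSubP (quad a b c d) {iv} fzero        j flips =
    cong (_∷ _) (interval-flip {iv = a , b} {iv} j flips)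
  flipP-toSubP (quad a b c d) {iv} (fsuc fzero) j flips =
    cong (interval _ (a , b) ∷_) (cong (_∷ []) (interval-flip {iv = c , d} {iv} j flips))

  lookup-flipP-toSubP : ∀ p (i : Fin 2) (j k : Fin n) →
                        lookup (lookup (flipP (i , j) (toSubP n p)) i) k ≡ flipped (lookup p i) (toℕ j) (toℕ k)
  lookup-flipP-toSubP (quad a b c d) fzero        j k = lookup-flip-interval (a , b) j k
  lookup-flipP-toSubP (quad a b c d) (fsuc fzero) j k = lookup-flip-interval (c , d) j k

∈P-toSubP : ∀ p (i : Fin 2) {k : Fin n} → (i , k) ∈P toSubP n p → toℕ k ∈ᴵ lookup p i
∈P-toSubP p i {k} k∈ = dec-true⁻¹ (toℕ k ∈ᴵ? lookup p i) (trans (sym (lookup-toSubP p i k)) k∈)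

toSubP-∋ : ∀ p (i : Fin 2) (k : Fin n) → toℕ k ∈ᴵ lookup p i → (i , k) ∈P toSubP n p
toSubP-∋ p i k k∈ = trans (lookup-toSubP p i k) (dec-true (toℕ k ∈ᴵ? lookup p i) k∈)

toSubP-top-≢ : ∀ {a b a′ b′ c′ d′} → c < d → d ≤ n → c′ < d′ → d′ ≤ n →
               c ≢ c′ ⊎ d ≢ d′ →
        toSubP n (quad a b c d) ≢ toSubP n (quad a′ b′ c′ d′)
toSubP-top-≢ {c} {d} {a = a} {b} {a′} {b′} {c′} {d′} c<d d≤n c′<d′ d′≤n differ eq
  with interval-injective c<d d≤n c′<d′ d′≤n
         (trans (sym (lookup-toSubP-row (quad a b c d) top))
                (trans (cong (λ I → lookup I top) eq) (lookup-toSubP-row (quad a′ b′ c′ d′) top)))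
... | c≡c′ , d≡d′ = Sum.[ (λ c≢c′ → c≢c′ c≡c′) , (λ d≢d′ → d≢d′ d≡d′) ] differ

-- Since (1, j) ≤ (2, k) iff j ≤ k, a pair is interval-closed iff an interval is empty, no upper
-- element lies above a lower one, or the upper interval neither starts nor ends later.
data Closed : IntervalPair → Set where
  bottom-empty : b ≤ a → Closed (quad a b c d)
  top-empty    : d ≤ c → Closed (quad a b c d)
  unrelated    : d ≤ a → Closed (quad a b c d)
  lagging      : c ≤ a → d ≤ b → Closed (quad a b c d)

closed? : ∀ p → Dec (Closed p)
closed? (quad a b c d) with b ≤? a | d ≤? c | d ≤? a | c ≤? a | d ≤? b
... | yes b≤a | _       | _       | _       | _       = yes (bottom-empty b≤a)
... | no _    | yes d≤c | _       | _       | _       = yes (top-empty d≤c)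
... | no _    | no _    | yes d≤a | _       | _       = yes (unrelated d≤a)
... | no _    | no _    | no _    | yes c≤a | yes d≤b = yes (lagging c≤a d≤b)
... | no b≰a  | no d≰c  | no d≰a  | no c≰a  | _       = no λ where
  (bottom-empty b≤a) → b≰a b≤a
  (top-empty d≤c)    → d≰c d≤c
  (unrelated d≤a)    → d≰a d≤a
  (lagging c≤a _)    → c≰a c≤a
... | no b≰a  | no d≰c  | no d≰a  | yes _   | no d≰b  = no λ where
  (bottom-empty b≤a) → b≰a b≤a
  (top-empty d≤c)    → d≰c d≤c
  (unrelated d≤a)    → d≰a d≤a
  (lagging _ d≤b)    → d≰b d≤b

¬closed : a < b → c < d → a < d → a < c ⊎ b < d → ¬ Closed (quad a b c d)
¬closed a<b _   _   _          (bottom-empty b≤a) = <⇒≱ a<b b≤a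
¬closed _   c<d _   _          (top-empty d≤c)    = <⇒≱ c<d d≤c
¬closed _   _   a<d _          (unrelated d≤a)    = <⇒≱ a<d d≤a
¬closed _   _   _   (inj₁ a<c) (lagging c≤a _)    = <⇒≱ a<c c≤a
¬closed _   _   _   (inj₂ b<d) (lagging _ d≤b)    = <⇒≱ b<d d≤b

closed-between : Closed (quad a b c d) → j ∈ᴵ (a , b) → k ∈ᴵ (c , d) →
                 ∀ {z} → j ≤ z → z ≤ k → z ∈ᴵ (a , b) × z ∈ᴵ (c , d)
closed-between (bottom-empty b≤a) (a≤j , j<b) _ _ _ = ⊥-elim (<⇒≱ (≤-<-trans a≤j j<b) b≤a)
closed-between (top-empty d≤c) _ (c≤k , k<d) _ _    = ⊥-elim (<⇒≱ (≤-<-trans c≤k k<d) d≤c)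
closed-between (unrelated d≤a) (a≤j , _) (_ , k<d) j≤z z≤k =
  ⊥-elim (<⇒≱ (≤-<-trans (≤-trans a≤j (≤-trans j≤z z≤k)) k<d) d≤a)
closed-between (lagging c≤a d≤b) (a≤j , _) (_ , k<d) j≤z z≤k =
  (≤-trans a≤j j≤z , <-≤-trans (≤-<-trans z≤k k<d) d≤b) ,
  (≤-trans c≤a (≤-trans a≤j j≤z) , ≤-<-trans z≤k k<d)

closed⇒IsICS : ∀ {p} → Closed p → IsICS (toSubP n p)
closed⇒IsICS {p = p@(quad a b c d)} cl (i , x) (i′ , y) (i″ , z) x∈ y∈
             (i≤i″ , x≤z) (i″≤i′ , z≤y) =
  toSubP-∋ p i″ z (rows i i′ i″ (∈P-toSubP p i x∈) (∈P-toSubP p i′ y∈) i≤i″ i″≤i′)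
  where
  rows : ∀ i i′ i″ → toℕ x ∈ᴵ lookup p i → toℕ y ∈ᴵ lookup p i′ →
         toℕ i ≤ toℕ i″ → toℕ i″ ≤ toℕ i′ → toℕ z ∈ᴵ lookup p i″
  rows fzero        fzero        fzero        x∈ y∈ _ _ = ∈ᴵ-convex x∈ y∈ x≤z z≤y
  rows (fsuc fzero) (fsuc fzero) (fsuc fzero) x∈ y∈ _ _ = ∈ᴵ-convex x∈ y∈ x≤z z≤y
  rows fzero        (fsuc fzero) fzero        x∈ y∈ _ _ = proj₁ (closed-between cl x∈ y∈ x≤z z≤y)
  rows fzero        (fsuc fzero) (fsuc fzero) x∈ y∈ _ _ = proj₂ (closed-between cl x∈ y∈ x≤z z≤y)
  rows fzero        fzero        (fsuc fzero) _  _  _ ()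
  rows (fsuc fzero) _            fzero        _  _  () _
  rows (fsuc fzero) fzero        (fsuc fzero) _  _  _ ()

module _ (I : SubP n) (i i′ i″ : Fin 2) {x y z : ℕ} (x<n : x < n) (y<n : y < n) (z<n : z < n) where

  three-points⇒¬IsICS : toℕ i ≤ toℕ i″ → toℕ i″ ≤ toℕ i′ → x ≤ z → z ≤ y →
                        (i , fromℕ< x<n) ∈P I → (i′ , fromℕ< y<n) ∈P I → ¬ (i″ , fromℕ< z<n) ∈P I →
                        ¬ IsICS I
  three-points⇒¬IsICS i≤i″ i″≤i′ x≤z z≤y x∈ y∈ z∉ ics =
    z∉ (ics _ _ _ x∈ y∈ (i≤i″ , subst₂ _≤_ (sym toℕ-x) (sym toℕ-z) x≤z)
                        (i″≤i′ , subst₂ _≤_ (sym toℕ-z) (sym toℕ-y) z≤y))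
    where toℕ-x = Fin.toℕ-fromℕ< x<n
          toℕ-y = Fin.toℕ-fromℕ< y<n
          toℕ-z = Fin.toℕ-fromℕ< z<n

module _ (p : IntervalPair) (i : Fin 2) (k<n : k < n) where

  toSubP-∋ℕ : k ∈ᴵ lookup p i → (i , fromℕ< k<n) ∈P toSubP n p
  toSubP-∋ℕ k∈ = toSubP-∋ p i _ (subst (_∈ᴵ lookup p i) (sym (Fin.toℕ-fromℕ< k<n)) k∈)

  toSubP-∌ℕ : ¬ k ∈ᴵ lookup p i → ¬ (i , fromℕ< k<n) ∈P toSubP n p
  toSubP-∌ℕ k∉ k∈ = k∉ (subst (_∈ᴵ lookup p i) (Fin.toℕ-fromℕ< k<n) (∈P-toSubP p i k∈))

-- (1, a+1) ≤ (2, d) are both in the set, but (2, a+1) or (1, d) between them is not.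
¬closed⇒¬IsICS : ∀ {p} → Bounded n p → ¬ Closed p → ¬ IsICS (toSubP n p)
¬closed⇒¬IsICS {p = quad a b c zero} _ ¬cl = ⊥-elim (¬cl (top-empty z≤n))
¬closed⇒¬IsICS {n} {p = p@(quad a b c (suc d′))} (b≤n , d′<n) ¬cl = by-cases (c ≤? a)
  where
  a<b  = ≰⇒> (¬cl ∘ bottom-empty)
  a≤d′ = ≤-pred (≰⇒> (¬cl ∘ unrelated))
  a<n  = <-≤-trans a<b b≤n
  a∈   = toSubP-∋ℕ p bottom a<n (≤-refl , a<b)
  d′∈  = toSubP-∋ℕ p top d′<n (≤-pred (≰⇒> (¬cl ∘ top-empty)) , ≤-refl)
  by-cases : Dec (c ≤ a) → ¬ IsICS (toSubP n p)
  by-cases (no c≰a)  = three-points⇒¬IsICS (toSubP n p) bottom top top a<n d′<n a<n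
                         z≤n ≤-refl ≤-refl a≤d′ a∈ d′∈
                         (toSubP-∌ℕ p top a<n λ (c≤a , _) → c≰a c≤a)
  by-cases (yes c≤a) = three-points⇒¬IsICS (toSubP n p) bottom top bottom a<n d′<n d′<n
                         ≤-refl z≤n a≤d′ ≤-refl a∈ d′∈
                         (toSubP-∌ℕ p bottom d′<n λ (_ , d′<b) → ¬cl (lagging c≤a d′<b))

gap⇒¬IsICS : ∀ p (i : Fin 2) (j : Fin n) {m} → Gap (flipped (lookup p i) (toℕ j)) m → m ≤ n →
             ¬ IsICS (flipP (i , j) (toSubP n p))
gap⇒¬IsICS {n} p i j
  record { p<r = p<r ; r<s = r<s ; s<bound = s<m ; p∈ = p∈ ; r∉ = r∉ ; s∈ = s∈ } m≤n =
  three-points⇒¬IsICS (flipP (i , j) (toSubP n p)) i i i p<n s<n r<n ≤-refl ≤-refl (<⇒≤ p<r) (<⇒≤ r<s)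
                      (bit p<n p∈) (bit s<n s∈) (λ r∈ → case trans (sym r∈) (bit r<n r∉) of λ ())
  where
  s<n = <-≤-trans s<m m≤n
  r<n = <-trans r<s s<n
  p<n = <-trans p<r r<n
  bit : ∀ {k v} (k<n : k < n) → flipped (lookup p i) (toℕ j) k ≡ v →
        lookup (lookup (flipP (i , j) (toSubP n p)) i) (fromℕ< k<n) ≡ v
  bit k<n eq =
    trans (lookup-flipP-toSubP p i j _) (trans (cong (flipped (lookup p i) (toℕ j)) (Fin.toℕ-fromℕ< k<n)) eq)

opaque
  toggleᴵ : Fin 2 → ℕ → IntervalPair → IntervalPair
  toggleᴵ i j p = maybe′ (λ iv → if does (closed? (p [ i ]≔ iv)) then p [ i ]≔ iv else p) p
                       (flipInterval (lookup p i) j)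

  toggleᴵ-fixed : ∀ {p} {i : Fin 2} → flipInterval (lookup p i) j ≡ nothing → toggleᴵ i j p ≡ p
  toggleᴵ-fixed eq rewrite eq = refl

  toggleᴵ-accept : ∀ {p} {i : Fin 2} {iv} → flipInterval (lookup p i) j ≡ just iv →
                   Closed (p [ i ]≔ iv) → toggleᴵ i j p ≡ p [ i ]≔ iv
  toggleᴵ-accept {p = p} {i} {iv} eq cl rewrite eq | dec-true (closed? (p [ i ]≔ iv)) cl = refl

  toggleᴵ-reject : ∀ {p} {i : Fin 2} {iv} → flipInterval (lookup p i) j ≡ just iv →
                   ¬ Closed (p [ i ]≔ iv) → toggleᴵ i j p ≡ p
  toggleᴵ-reject {p = p} {i} {iv} eq ¬cl rewrite eq | dec-false (closed? (p [ i ]≔ iv)) ¬cl = refl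

toggle-accepted : ∀ x (I : SubP n) → IsICS (flipP x I) → toggle x I ≡ flipP x I
toggle-accepted x I ics with isICS? (flipP x I)
... | yes _   = refl
... | no ¬ics = contradiction ics ¬ics

toggle-rejected : ∀ x (I : SubP n) → ¬ IsICS (flipP x I) → toggle x I ≡ I
toggle-rejected x I ¬ics with isICS? (flipP x I)
... | yes ics = contradiction ics ¬ics
... | no _    = refl

data ToggleView (i : Fin 2) (j : ℕ) (p : IntervalPair) : Set where
  not-interval : Gap (flipped (lookup p i) j) (proj₂ (lookup p i) ⊔ suc j) → toggleᴵ i j p ≡ p →
                 ToggleView i j p
  accepted     : ∀ {iv} → FlipsTo (lookup p i) j iv → proj₂ iv ≤ proj₂ (lookup p i) ⊔ suc j →
                 Closed (p [ i ]≔ iv) → toggleᴵ i j p ≡ p [ i ]≔ iv → ToggleView i j p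
  rejected     : ∀ {iv} → FlipsTo (lookup p i) j iv → proj₂ iv ≤ proj₂ (lookup p i) ⊔ suc j →
                 ¬ Closed (p [ i ]≔ iv) → toggleᴵ i j p ≡ p → ToggleView i j p

toggleᴵ-view : ∀ i j p → ToggleView i j p
toggleᴵ-view i j p = by-flip (flipInterval (lookup p i) j) refl (flipInterval-spec (lookup p i) j)
  where
  by-flip : ∀ r → flipInterval (lookup p i) j ≡ r → FlipSpec (lookup p i) j r → ToggleView i j p
  by-flip nothing   eq gap = not-interval gap (toggleᴵ-fixed eq)
  by-flip (just iv) eq (flips , hi≤) with closed? (p [ i ]≔ iv)
  ... | yes cl = accepted flips hi≤ cl (toggleᴵ-accept eq cl)
  ... | no ¬cl = rejected flips hi≤ ¬cl (toggleᴵ-reject eq ¬cl)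

toggle-toSubP : ∀ {p} (i : Fin 2) (j : Fin n) → Bounded n p →
                toggle (i , j) (toSubP n p) ≡ toSubP n (toggleᴵ i (toℕ j) p)
toggle-toSubP {n} {p} i j bounded = by-view (toggleᴵ-view i (toℕ j) p)
  where
  flip≤n = ⊔-lub (bounded-lookup i bounded) (Fin.toℕ<n j)
  by-view : ToggleView i (toℕ j) p → toggle (i , j) (toSubP n p) ≡ toSubP n (toggleᴵ i (toℕ j) p)
  by-view (not-interval gap eq) =
    trans (toggle-rejected (i , j) (toSubP n p) (gap⇒¬IsICS p i j gap flip≤n)) (cong (toSubP n) (sym eq))
  by-view (accepted flips _ cl eq) =
    trans (toggle-accepted (i , j) (toSubP n p) (subst IsICS (sym flipped≡) (closed⇒IsICS cl)))
          (trans flipped≡ (cong (toSubP n) (sym eq)))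
    where flipped≡ = flipP-toSubP p i j flips
  by-view (rejected flips hi≤ ¬cl eq) =
    trans (toggle-rejected (i , j) (toSubP n p)
                           (subst (¬_ ∘ IsICS) (sym (flipP-toSubP p i j flips))
                                  (¬closed⇒¬IsICS (bounded-update i bounded (≤-trans hi≤ flip≤n)) ¬cl)))
          (cong (toSubP n) (sym eq))

toggleᴵ-bounded : ∀ {p} (i : Fin 2) → j < n → Bounded n p → Bounded n (toggleᴵ i j p)
toggleᴵ-bounded {j} {n} {p} i j<n bounded = by-view (toggleᴵ-view i j p)
  where
  by-view : ToggleView i j p → Bounded n (toggleᴵ i j p)
  by-view (not-interval _ eq)   = subst (Bounded n) (sym eq) bounded
  by-view (accepted _ hi≤ _ eq) =
    subst (Bounded n) (sym eq) (bounded-update i bounded (≤-trans hi≤ (⊔-lub (bounded-lookup i bounded) j<n)))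
  by-view (rejected _ _ _ eq)   = subst (Bounded n) (sym eq) bounded

foldr-toggle : ∀ {p} (i : Fin 2) (js : List (Fin n)) → Bounded n p →
               foldr toggle (toSubP n p) (List.map (i ,_) js) ≡ toSubP n (foldr (toggleᴵ i) p (List.map toℕ js))
               × Bounded n (foldr (toggleᴵ i) p (List.map toℕ js))
foldr-toggle i []       bounded = refl , bounded
foldr-toggle i (j ∷ js) bounded =
  trans (cong (toggle (i , j)) eq) (toggle-toSubP i j bounded′) , toggleᴵ-bounded i (Fin.toℕ<n j) bounded′
  where eq       = proj₁ (foldr-toggle i js bounded)
        bounded′ = proj₂ (foldr-toggle i js bounded)

-- Rowmotion as two right-to-left sweeps

tabulate-toℕ : ∀ {A : Set} n (f : ℕ → A) → List.tabulate {n = n} (f ∘ toℕ) ≡ applyUpTo f n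
tabulate-toℕ zero    f = refl
tabulate-toℕ (suc n) f = cong (f 0 ∷_) (tabulate-toℕ n (f ∘ suc))

map-toℕ-allFin : ∀ n → List.map toℕ (allFin n) ≡ upTo n
map-toℕ-allFin n = trans (map-tabulate id toℕ) (tabulate-toℕ n id)

-- Sweep f lo hi x y: applying f (hi − 1), f (hi − 2), …, f lo to x gives y.
data Sweep {A : Set} (f : ℕ → A → A) : ℕ → ℕ → A → A → Set where
  stay : ∀ {m x} → Sweep f m m x x
  step : ∀ {lo hi x y} → Sweep f lo hi (f hi x) y → Sweep f lo (suc hi) x y

module _ {A : Set} {f : ℕ → A → A} where

  infixr 5 _▸_

  _▸_ : ∀ {m x y z} → Sweep f m hi x y → Sweep f lo m y z → Sweep f lo hi x z
  stay   ▸ t = t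
  step s ▸ t = step (s ▸ t)

  sweep-foldr : ∀ {x y} → Sweep f 0 n x y → foldr f x (upTo n) ≡ y
  sweep-foldr stay = refl
  sweep-foldr {x = x} (step {hi = hi} s) =
    trans (cong (foldr f x) (sym (upTo-∷ʳ hi))) (trans (foldr-∷ʳ f x hi (upTo hi)) (sweep-foldr s))

  sweep-at : ∀ {x y} → f j x ≡ y → Sweep f j (suc j) x y
  sweep-at eq = step (subst (λ x → Sweep f _ _ x _) (sym eq) stay)

  sweep-track : (g : ℕ → A) → lo ≤ hi → (∀ j → lo ≤ j → j < hi → f j (g (suc j)) ≡ g j) →
                Sweep f lo hi (g hi) (g lo)
  sweep-track {lo} g lo≤hi = go (≤⇒≤′ lo≤hi)
    where
    go : lo ≤′ hi → (∀ j → lo ≤ j → j < hi → f j (g (suc j)) ≡ g j) → Sweep f lo hi (g hi) (g lo)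
    go ≤′-refl _ = stay
    go (≤′-step {h} lo≤′h) steps =
      step (subst (λ x → Sweep f lo h x (g lo)) (sym (steps h (≤′⇒≤ lo≤′h) ≤-refl))
                  (go lo≤′h λ j lo≤j j<h → steps j lo≤j (m<n⇒m<1+n j<h)))

  sweep-fixed : ∀ {x} → lo ≤ hi → (∀ j → lo ≤ j → j < hi → f j x ≡ x) → Sweep f lo hi x x
  sweep-fixed {x = x} = sweep-track (λ _ → x)

sweep-row : ∀ {p q} (i : Fin 2) → Bounded n p → Sweep (toggleᴵ i) 0 n p q →
            foldr toggle (toSubP n p) (List.map (i ,_) (allFin n)) ≡ toSubP n q × Bounded n q
sweep-row {n} {p} i bounded sweep =
  subst (λ q → foldr toggle (toSubP n p) (List.map (i ,_) (allFin n)) ≡ toSubP n q × Bounded n q)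
        (trans (cong (foldr (toggleᴵ i) p) (map-toℕ-allFin n)) (sweep-foldr sweep))
        (foldr-toggle i (allFin n) bounded)

-- Row unfolds into every toggle and its IsICS test; stating the orbit computations for this
-- opaque copy keeps the type checker from normalising it whenever two states are compared.
opaque
  rowmotion : SubP n → SubP n
  rowmotion = Row

opaque
  unfolding rowmotion

  rowmotion-sweeps : ∀ {p q r} → Bounded n p →
                     Sweep (toggleᴵ top) 0 n p q → Sweep (toggleᴵ bottom) 0 n q r →
                     rowmotion (toSubP n p) ≡ toSubP n r
  rowmotion-sweeps {n} {p} {q} {r} bounded top-sweep bottom-sweep = begin
    foldr toggle (toSubP n p) (bottoms List.++ tops List.++ [])
      ≡⟨ foldr-++ toggle (toSubP n p) bottoms (tops List.++ []) ⟩
    foldr toggle (foldr toggle (toSubP n p) (tops List.++ [])) bottoms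
      ≡⟨ cong (λ js → foldr toggle (foldr toggle (toSubP n p) js) bottoms) (++-identityʳ tops) ⟩
    foldr toggle (foldr toggle (toSubP n p) tops) bottoms
      ≡⟨ cong (λ I → foldr toggle I bottoms) (proj₁ top-pass) ⟩
    foldr toggle (toSubP n q) bottoms
      ≡⟨ proj₁ (sweep-row bottom (proj₂ top-pass) bottom-sweep) ⟩
    toSubP n r ∎
    where
    open ≡-Reasoning
    tops bottoms : List (Elt n)
    tops    = List.map (top ,_) (allFin n)
    bottoms = List.map (bottom ,_) (allFin n)
    top-pass : foldr toggle (toSubP n p) tops ≡ toSubP n q × Bounded n q
    top-pass = sweep-row top bounded top-sweep

sweep-top-shift : c < a → c < d → d < b → d < n →
                  Sweep (toggleᴵ top) 0 n (quad a b c d) (quad a b (suc c) (suc d))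
sweep-top-shift c<a c<d d<b d<n =
  sweep-fixed d<n (λ j d<j _ → toggleᴵ-fixed (flipInterval-away c<d (right d<j)))
  ▸ sweep-at (toggleᴵ-accept (flipInterval-addHi c<d) (lagging (<⇒≤ c<a) d<b))
  ▸ sweep-fixed c<d (λ j c<j j<d → toggleᴵ-fixed (flipInterval-away (m<n⇒m<1+n c<d) (inside c<j (s≤s j<d))))
  ▸ sweep-at (toggleᴵ-accept (flipInterval-removeLo (m<n⇒m<1+n c<d)) (lagging c<a d<b))
  ▸ sweep-fixed z≤n (λ j _ j<c → toggleᴵ-fixed (flipInterval-away (s≤s c<d) (left (s≤s j<c))))

sweep-top-grow : a < d → d < b → d < n → Sweep (toggleᴵ top) 0 n (quad a b a d) (quad a b 0 (suc d))
sweep-top-grow {a} {d} {b} a<d d<b d<n =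
  sweep-fixed d<n (λ j d<j _ → toggleᴵ-fixed (flipInterval-away a<d (right d<j)))
  ▸ sweep-at (toggleᴵ-accept (flipInterval-addHi a<d) (lagging ≤-refl d<b))
  ▸ sweep-fixed a<d (λ j a<j j<d → toggleᴵ-fixed (flipInterval-away (m<n⇒m<1+n a<d) (inside a<j (s≤s j<d))))
  ▸ sweep-at (toggleᴵ-reject (flipInterval-removeLo (m<n⇒m<1+n a<d))
                             (¬closed (<-trans a<d d<b) (s≤s a<d) (m<n⇒m<1+n a<d) (inj₁ ≤-refl)))
  ▸ sweep-track (λ j → quad a b j (suc d)) z≤n (λ j _ j<a →
      toggleᴵ-accept (flipInterval-addLo (s≤s (<-trans j<a a<d))) (lagging (<⇒≤ j<a) d<b))

sweep-top-shrink : suc c ≤ a → a < d → d ≤ n →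
                   Sweep (toggleᴵ top) 0 n (quad a d (suc c) d) (quad a d 0 (suc c))
sweep-top-shrink {c} {a} {d} c<a a<d d≤n =
  sweep-fixed d≤n (λ j d≤j _ → beyond j (m≤n⇒m<n∨m≡n d≤j))
  ▸ sweep-track (λ j → quad a d (suc c) j) sc<d (λ j sc<j j<d →
      toggleᴵ-accept (flipInterval-removeHi sc<j) (lagging c<a (<⇒≤ j<d)))
  ▸ sweep-at (toggleᴵ-accept (flipInterval-removeLo ≤-refl) (top-empty ≤-refl))
  ▸ sweep-at (toggleᴵ-accept (flipInterval-empty ≤-refl) (lagging (<⇒≤ c<a) (<⇒≤ sc<d)))
  ▸ sweep-track (λ j → quad a d j (suc c)) z≤n (λ j _ j<c →
      toggleᴵ-accept (flipInterval-addLo (s≤s j<c)) (lagging (<⇒≤ (<-trans j<c c<a)) (<⇒≤ sc<d)))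
  where
  sc<d = <-≤-trans (s≤s c<a) a<d
  beyond : ∀ j → d < j ⊎ d ≡ j → toggleᴵ top j (quad a d (suc c) d) ≡ quad a d (suc c) d
  beyond j (inj₁ d<j)  = toggleᴵ-fixed (flipInterval-away sc<d (right d<j))
  beyond j (inj₂ refl) = toggleᴵ-reject (flipInterval-addHi sc<d)
                                        (¬closed a<d (m<n⇒m<1+n sc<d) (m<n⇒m<1+n a<d) (inj₂ ≤-refl))

sweep-bottom-shift : a < b → b < n → c ≤ a → d ≤ b →
                     Sweep (toggleᴵ bottom) 0 n (quad a b c d) (quad (suc a) (suc b) c d)
sweep-bottom-shift a<b b<n c≤a d≤b =
  sweep-fixed b<n (λ j b<j _ → toggleᴵ-fixed (flipInterval-away a<b (right b<j)))
  ▸ sweep-at (toggleᴵ-accept (flipInterval-addHi a<b) (lagging c≤a (m≤n⇒m≤1+n d≤b)))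
  ▸ sweep-fixed a<b (λ j a<j j<b → toggleᴵ-fixed (flipInterval-away (m<n⇒m<1+n a<b) (inside a<j (s≤s j<b))))
  ▸ sweep-at (toggleᴵ-accept (flipInterval-removeLo (m<n⇒m<1+n a<b))
                             (lagging (m≤n⇒m≤1+n c≤a) (m≤n⇒m≤1+n d≤b)))
  ▸ sweep-fixed z≤n (λ j _ j<a → toggleᴵ-fixed (flipInterval-away (s≤s a<b) (left (s≤s j<a))))

sweep-bottom-cut : c ≤ a → a < d → d ≤ n →
                   Sweep (toggleᴵ bottom) 0 n (quad a n c d) (quad (suc a) d c d)
sweep-bottom-cut {c} {a} {d} c≤a a<d d≤n =
  sweep-track (λ j → quad a j c d) d≤n (λ j d≤j _ →
    toggleᴵ-accept (flipInterval-removeHi (<-≤-trans a<d d≤j)) (lagging c≤a d≤j))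
  ▸ sweep-fixed a<d (λ j a<j j<d → below-top j a<j (m≤n⇒m<n∨m≡n j<d))
  ▸ sweep-at (toggleᴵ-accept (flipInterval-removeLo a<d) (lagging (m≤n⇒m≤1+n c≤a) ≤-refl))
  ▸ sweep-fixed z≤n (λ j _ j<a → below-bottom j j<a (m≤n⇒m<n∨m≡n a<d))
  where
  c<d = ≤-<-trans c≤a a<d
  below-top : ∀ j → a < j → suc j < d ⊎ suc j ≡ d → toggleᴵ bottom j (quad a d c d) ≡ quad a d c d
  below-top j a<j (inj₁ sj<d) = toggleᴵ-fixed (flipInterval-away a<d (inside a<j sj<d))
  below-top j a<j (inj₂ refl) =
    toggleᴵ-reject (flipInterval-removeHi a<j) (¬closed a<j c<d a<d (inj₂ ≤-refl))
  below-bottom : ∀ j → j < a → suc a < d ⊎ suc a ≡ d →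
                 toggleᴵ bottom j (quad (suc a) d c d) ≡ quad (suc a) d c d
  below-bottom j j<a (inj₁ sa<d) = toggleᴵ-fixed (flipInterval-away sa<d (left (s≤s j<a)))
  below-bottom j j<a (inj₂ refl) =
    toggleᴵ-reject (flipInterval-empty ≤-refl) (¬closed ≤-refl c<d (<-trans j<a a<d) (inj₂ (s≤s j<a)))

sweep-bottom-wrap : c < d → d ≤ suc a → suc a < n →
                    Sweep (toggleᴵ bottom) 0 n (quad (suc a) n c d) (quad c (suc a) c d)
sweep-bottom-wrap {c} {d} {a} c<d d≤sa sa<n =
  sweep-track (λ j → quad (suc a) j c d) sa<n (λ j sa<j _ →
    toggleᴵ-accept (flipInterval-removeHi sa<j) (unrelated d≤sa))
  ▸ sweep-at (toggleᴵ-accept (flipInterval-removeLo ≤-refl) (bottom-empty ≤-refl))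
  ▸ sweep-at (toggleᴵ-accept (flipInterval-empty ≤-refl) (lagging c≤a d≤sa))
  ▸ sweep-track (λ j → quad j (suc a) c d) c≤a (λ j c≤j j<a →
      toggleᴵ-accept (flipInterval-addLo (s≤s j<a)) (lagging c≤j d≤sa))
  ▸ sweep-fixed z≤n (λ j _ j<c → below j j<c (m≤n⇒m<n∨m≡n j<c))
  where
  c≤a = ≤-pred (<-≤-trans c<d d≤sa)
  below : ∀ j → j < c → suc j < c ⊎ suc j ≡ c →
          toggleᴵ bottom j (quad c (suc a) c d) ≡ quad c (suc a) c d
  below j _ (inj₁ sj<c) = toggleᴵ-fixed (flipInterval-away (s≤s c≤a) (left sj<c))
  below j j<c (inj₂ refl) =
    toggleᴵ-reject (flipInterval-addLo (s≤s c≤a))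
                   (¬closed (s≤s (<⇒≤ c≤a)) c<d (<-trans j<c c<d) (inj₁ j<c))

rowmotion-shift : c < a → a < b → c < d → d < b → b < n →
                  rowmotion (toSubP n (quad a b c d)) ≡ toSubP n (quad (suc a) (suc b) (suc c) (suc d))
rowmotion-shift c<a a<b c<d d<b b<n =
  rowmotion-sweeps (<⇒≤ b<n , <⇒≤ d<n) (sweep-top-shift c<a c<d d<b d<n)
                   (sweep-bottom-shift a<b b<n c<a d<b)
  where d<n = <-trans d<b b<n

rowmotion-grow-shift : a < d → d < b → b < n →
                       rowmotion (toSubP n (quad a b a d)) ≡ toSubP n (quad (suc a) (suc b) 0 (suc d))
rowmotion-grow-shift a<d d<b b<n =
  rowmotion-sweeps (<⇒≤ b<n , <⇒≤ d<n) (sweep-top-grow a<d d<b d<n)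
                   (sweep-bottom-shift (<-trans a<d d<b) b<n z≤n d<b)
  where d<n = <-trans d<b b<n

rowmotion-shrink-shift : suc c ≤ a → a < d → d < n →
                         rowmotion (toSubP n (quad a d (suc c) d)) ≡ toSubP n (quad (suc a) (suc d) 0 (suc c))
rowmotion-shrink-shift c<a a<d d<n =
  rowmotion-sweeps (<⇒≤ d<n , <⇒≤ d<n) (sweep-top-shrink c<a a<d (<⇒≤ d<n))
                   (sweep-bottom-shift a<d d<n z≤n (<⇒≤ (≤-<-trans c<a a<d)))

rowmotion-shrink-wrap : suc c ≤ suc a → suc a < n → d ≡ n →
                        rowmotion (toSubP n (quad (suc a) d (suc c) d)) ≡ toSubP n (quad 0 (suc a) 0 (suc c))
rowmotion-shrink-wrap c<a sa<n refl =
  rowmotion-sweeps (≤-refl , ≤-refl) (sweep-top-shrink c<a sa<n ≤-refl) (sweep-bottom-wrap z<s c<a sa<n)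

rowmotion-shift-wrap : c < d → d ≤ a → suc a < n → b ≡ n →
                       rowmotion (toSubP n (quad (suc a) b c d)) ≡
                       toSubP n (quad (suc c) (suc a) (suc c) (suc d))
rowmotion-shift-wrap c<d d≤a sa<n refl =
  rowmotion-sweeps (≤-refl , <⇒≤ d<n) (sweep-top-shift (m<n⇒m<1+n (<-≤-trans c<d d≤a)) c<d d<n d<n)
                   (sweep-bottom-wrap (s≤s c<d) (s≤s d≤a) sa<n)
  where d<n = ≤-<-trans (m≤n⇒m≤1+n d≤a) sa<n

rowmotion-shift-cut : c < a → a ≤ d → d < n → b ≡ n →
                      rowmotion (toSubP n (quad a b c d)) ≡ toSubP n (quad (suc a) (suc d) (suc c) (suc d))
rowmotion-shift-cut c<a a≤d d<n refl =
  rowmotion-sweeps (≤-refl , <⇒≤ d<n) (sweep-top-shift c<a (<-≤-trans c<a a≤d) d<n d<n)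
                   (sweep-bottom-cut c<a (s≤s a≤d) d<n)

-- Orbits as closed walks

CycleLength : {A : Set} → (A → A) → A → ℕ → Set
CycleLength f x s = (1 ≤ s) × (iter f s x ≡ x) × (∀ k → 1 ≤ k → k < s → iter f k x ≢ x)

Reaches : {A : Set} → (A → A) → A → A → Set
Reaches f x y = ∃ λ k → iter f k x ≡ y

data Walk {A : Set} (f : A → A) : A → List A → A → Set where
  []  : ∀ {x} → Walk f x [] x
  _∷_ : ∀ {x y ys z} → f x ≡ y → Walk f y ys z → Walk f x (y ∷ ys) z

module _ {A : Set} {f : A → A} where

  infixr 5 _++ʷ_

  _++ʷ_ : ∀ {x ys y zs z} → Walk f x ys y → Walk f y zs z → Walk f x (ys List.++ zs) z
  []      ++ʷ w′ = w′
  (e ∷ w) ++ʷ w′ = e ∷ (w ++ʷ w′)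

  walk-applyUpTo : (g : ℕ → A) → (∀ i → i < k → f (g i) ≡ g (suc i)) →
                   Walk f (g 0) (applyUpTo (g ∘ suc) k) (g k)
  walk-applyUpTo {zero}  g steps = []
  walk-applyUpTo {suc k} g steps = steps 0 z<s ∷ walk-applyUpTo (g ∘ suc) (λ i i<k → steps (suc i) (s≤s i<k))

  iter-shift : ∀ k x → iter f k (f x) ≡ iter f (suc k) x
  iter-shift zero    x = refl
  iter-shift (suc k) x = cong f (iter-shift k x)

  walk-iter : ∀ {x ys y} → Walk f x ys y → iter f (length ys) x ≡ y
  walk-iter []                = refl
  walk-iter {x} (_∷_ {ys = ys} e w) =
    trans (sym (iter-shift (length ys) x)) (trans (cong (iter f (length ys)) e) (walk-iter w))

  walk-visits : ∀ {x ys y} → Walk f x ys y → ∀ k → k < length ys → iter f (suc k) x ∈ ys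
  walk-visits (e ∷ w) zero    _         = here e
  walk-visits {x} (e ∷ w) (suc k) (s≤s k<) =
    there (subst (_∈ _) (trans (cong (iter f (suc k)) (sym e)) (iter-shift (suc k) x)) (walk-visits w k k<))

  walk-successor : ∀ {x ys y u} → Walk f x ys y → u ∈ x ∷ ys → f u ∈ ys ⊎ u ≡ y
  walk-successor []      (here refl) = inj₂ refl
  walk-successor (e ∷ w) (here refl) = inj₁ (here e)
  walk-successor (e ∷ w) (there u∈)  = Sum.map₁ there (walk-successor w u∈)

  cycle-closed : ∀ {x ys y} → Walk f x ys y → f y ≡ x → ∀ k → iter f k x ∈ x ∷ ys
  cycle-closed w back zero    = here refl
  cycle-closed w back (suc k) with walk-successor w (cycle-closed w back k)
  ... | inj₁ fu∈  = there fu∈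
  ... | inj₂ refl = here back

  cycle-length : ∀ {x ys y s} → Walk f x ys y → f y ≡ x → x ∉ ys → suc (length ys) ≡ s →
                 CycleLength f x s
  cycle-length w back x∉ refl =
    s≤s z≤n , trans (cong f (walk-iter w)) back ,
    λ where (suc k) _ (s≤s k<) returns → x∉ (subst (_∈ _) returns (walk-visits w k k<))

  cycle-¬reaches : ∀ {x ys y z} → Walk f x ys y → f y ≡ x → z ∉ x ∷ ys → ¬ Reaches f x z
  cycle-¬reaches w back z∉ (k , reaches) = z∉ (subst (_∈ _) reaches (cycle-closed w back k))

opaque
  unfolding rowmotion

  atLeastOrbits : ∀ {m s} (L : List (SubP n)) → m ≤ length L →
                  All.All (λ I → IsICS I × CycleLength rowmotion I s) L →
                  AllPairs.AllPairs (λ I J → ¬ Reaches rowmotion I J) L → AtLeastOrbits m n s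
  atLeastOrbits L m≤ cycles apart = L , m≤ , cycles , apart

single-orbit : ∀ {I : SubP n} {s} → IsICS I × CycleLength rowmotion I s → AtLeastOrbits 1 n s
single-orbit orbit = atLeastOrbits List.[ _ ] ≤-refl (orbit All.∷ All.[]) (All.[] AllPairs.∷ AllPairs.[])

-- n = 3K: one orbit of size K + 1

module DivisibleByThree (k : ℕ) where

  K N : ℕ
  K = suc k
  N = K + (K + K)

  start : IntervalPair
  start = quad K (K + K) K (K + K)

  shifted : ℕ → IntervalPair
  shifted u = quad (suc u + K) (suc u + (K + K)) u (u + K)

  first-step : rowmotion (toSubP N start) ≡ toSubP N (shifted 0)
  first-step = rowmotion-shrink-shift ≤-refl (m<m+n K z<s) (m<n+m (K + K) z<s)

  next-step : ∀ u → u < k → rowmotion (toSubP N (shifted u)) ≡ toSubP N (shifted (suc u))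
  next-step u u<k = rowmotion-shift (s≤s (m≤m+n u K)) (+-monoʳ-< (suc u) (m<m+n K z<s)) (m<m+n u z<s)
                                    (s≤s (+-monoʳ-≤ u (m≤m+n K K))) (+-monoˡ-< (K + K) (s≤s u<k))

  last-step : rowmotion (toSubP N (shifted k)) ≡ toSubP N start
  last-step = rowmotion-shift-wrap (m<m+n k z<s) ≤-refl (m<n+m (K + K) z<s) refl

  orbit : Walk rowmotion (toSubP N start) (applyUpTo (toSubP N ∘ shifted) K) (toSubP N (shifted k))
  orbit = first-step ∷ walk-applyUpTo (toSubP N ∘ shifted) next-step

  start∉orbit : toSubP N start ∉ applyUpTo (toSubP N ∘ shifted) K
  start∉orbit = All.All¬⇒¬Any (All.applyUpTo⁺₁ (toSubP N ∘ shifted) K λ {u} u<K →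
    toSubP-top-≢ (m<m+n K z<s) (m≤n+m (K + K) K)
                 (m<m+n u z<s) (≤-trans (+-monoˡ-≤ K (<⇒≤ u<K)) (m≤n+m (K + K) K))
                 (inj₁ (>⇒≢ u<K)))

  start-orbit : IsICS (toSubP N start) × CycleLength rowmotion (toSubP N start) (suc K)
  start-orbit = closed⇒IsICS (lagging ≤-refl ≤-refl) ,
                cycle-length orbit last-step start∉orbit
                             (cong suc (length-applyUpTo (toSubP N ∘ shifted) K))

-- n = 2M + 1: M orbits of size M + 2

module OddStates (w v : ℕ) where

  M N : ℕ
  M = suc (w + v)
  N = M + suc M

  start : IntervalPair
  start = quad v (v + suc M) v (v + suc w)

  wide : ℕ → IntervalPair
  wide s = quad (suc (s + v)) (suc (s + v) + suc M) s (s + suc M)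

  pivot : IntervalPair
  pivot = quad (suc M) (suc (w + suc M)) (suc w) (suc (w + suc M))

  narrow : ℕ → IntervalPair
  narrow t = quad (suc (t + suc M)) (suc (t + suc (w + suc M))) t (t + suc w)

  after-pivot : ℕ → IntervalPair
  after-pivot zero    = pivot
  after-pivot (suc t) = narrow t

-- Opaque: otherwise checking odd-orbit-closes evaluates this ring-solver proof to refl.
opaque
  narrow-end≡N : ∀ w v′ → suc (v′ + suc (w + suc (suc (w + suc v′)))) ≡
                          suc (w + suc v′) + suc (suc (w + suc v′))
  narrow-end≡N w v′ = solve (w List.∷ List.[ v′ ])

odd-orbit-closes : ∀ w v → let open OddStates w v in
                   rowmotion (toSubP N (after-pivot v)) ≡ toSubP N start
odd-orbit-closes w zero =
  rowmotion-shrink-wrap (s≤s (m≤n⇒m≤1+n (m≤m+n w 0))) (m<n+m (suc M) z<s)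
                        (cong (λ x → suc (x + suc M)) (sym (+-identityʳ w)))
  where open OddStates w zero
odd-orbit-closes w (suc v′) =
  rowmotion-shift-wrap (m<m+n v′ z<s) (+-monoʳ-≤ v′ (s≤s (m≤n⇒m≤1+n (m≤m+n w (suc v′)))))
                       (+-monoˡ-< (suc M) (s≤s (<-≤-trans (n<1+n v′) (m≤n+m (suc v′) w))))
                       (narrow-end≡N w v′)
  where open OddStates w (suc v′)

module OddOrbit (w v : ℕ) where

  open OddStates w v

  v+suc-w≡M : v + suc w ≡ M
  v+suc-w≡M = trans (+-suc v w) (cong suc (+-comm v w))

  first-step : rowmotion (toSubP N start) ≡ toSubP N (wide 0)
  first-step =
    trans (rowmotion-grow-shift (m<m+n v z<s) (+-monoʳ-< v (s≤s (s≤s (m≤m+n w v))))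
                                (+-monoˡ-< (suc M) (s≤s (m≤n+m v w))))
          (cong (λ x → toSubP N (quad (suc v) (suc (v + suc M)) 0 (suc x))) v+suc-w≡M)

  wide-step : ∀ s → s < w → rowmotion (toSubP N (wide s)) ≡ toSubP N (wide (suc s))
  wide-step s s<w =
    rowmotion-shift (s≤s (m≤m+n s v)) (m<m+n (suc (s + v)) z<s) (m<m+n s z<s)
                    (+-monoˡ-< (suc M) (s≤s (m≤m+n s v))) (+-monoˡ-< (suc M) (s≤s (+-monoˡ-< v s<w)))

  to-pivot : rowmotion (toSubP N (wide w)) ≡ toSubP N pivot
  to-pivot = rowmotion-shift-cut (s≤s (m≤m+n w v)) (≤-trans (n≤1+n M) (m≤n+m (suc M) w))
                                 (+-monoˡ-< (suc M) (s≤s (m≤m+n w v))) refl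

  narrow-step : ∀ t → t < v → rowmotion (toSubP N (after-pivot t)) ≡ toSubP N (after-pivot (suc t))
  narrow-step zero 0<v =
    rowmotion-shrink-shift (s≤s (m≤n⇒m≤1+n (m≤m+n w v))) (s≤s (m≤n+m (suc M) w))
                           (+-monoˡ-< (suc M) (s≤s (m<m+n w 0<v)))
  narrow-step (suc t) st<v =
    rowmotion-shift (s≤s (m≤m+n t (suc M))) (s≤s (+-monoʳ-< t (s≤s (m≤n+m (suc M) w)))) (m<m+n t z<s)
                    (s≤s (+-monoʳ-≤ t (s≤s (m≤m+n w (suc M)))))
                    (s≤s (subst₂ _≤_ lhs rhs (+-monoˡ-≤ (w + suc M) st<v)))
    where lhs : suc (suc t) + (w + suc M) ≡ suc (t + suc (w + suc M))
          lhs = cong suc (sym (+-suc t (w + suc M)))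
          rhs : v + (w + suc M) ≡ w + v + suc M
          rhs = trans (sym (+-assoc v w (suc M))) (cong (_+ suc M) (+-comm v w))

  orbit-list : List (SubP N)
  orbit-list = applyUpTo (toSubP N ∘ wide) (suc w) List.++ toSubP N pivot ∷ applyUpTo (toSubP N ∘ narrow) v

  orbit : Walk rowmotion (toSubP N start) orbit-list (toSubP N (after-pivot v))
  orbit = (first-step ∷ walk-applyUpTo (toSubP N ∘ wide) wide-step)
          ++ʷ (to-pivot ∷ walk-applyUpTo (toSubP N ∘ after-pivot) narrow-step)

  orbit-length : suc (length orbit-list) ≡ suc (suc M)
  orbit-length = cong suc (begin
    length orbit-list                 ≡⟨ length-++ (applyUpTo (toSubP N ∘ wide) (suc w)) ⟩
    length (applyUpTo (toSubP N ∘ wide) (suc w)) + suc (length (applyUpTo (toSubP N ∘ narrow) v))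
      ≡⟨ cong₂ (λ x y → x + suc y) (length-applyUpTo (toSubP N ∘ wide) (suc w))
                                   (length-applyUpTo (toSubP N ∘ narrow) v) ⟩
    suc w + suc v                     ≡⟨ cong suc (+-suc w v) ⟩
    suc M                             ∎)
    where open ≡-Reasoning

  ≢-beyond-M : ∀ {d} → d ≡ M → ∀ s → d ≢ s + suc M
  ≢-beyond-M refl s = <⇒≢ (<-≤-trans (n<1+n M) (m≤n+m (suc M) s))

  ∉-orbit : ∀ {a b c d} → c < d → d ≡ M →
            (∀ t → t < v → c ≢ t ⊎ d ≢ t + suc w) → toSubP N (quad a b c d) ∉ orbit-list
  ∉-orbit {c = c} {d} c<d d≡M narrow-differs = All.All¬⇒¬Any (All.++⁺
    (All.applyUpTo⁺₁ (toSubP N ∘ wide) (suc w) λ {s} s≤w →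
      toSubP-top-≢ c<d d≤N (m<m+n s z<s)
                   (+-monoˡ-≤ (suc M) (m≤n⇒m≤1+n (≤-trans (≤-pred s≤w) (m≤m+n w v))))
                   (inj₂ (≢-beyond-M d≡M s)))
    (toSubP-top-≢ c<d d≤N (s≤s (m<m+n w z<s)) (+-monoˡ-≤ (suc M) (s≤s (m≤m+n w v)))
                  (inj₂ (≢-beyond-M d≡M (suc w)))
     All.∷ All.applyUpTo⁺₁ (toSubP N ∘ narrow) v λ {t} t<v →
       toSubP-top-≢ c<d d≤N (m<m+n t z<s)
                    (≤-trans (+-monoˡ-≤ (suc w) (<⇒≤ t<v)) (≤-trans (≤-reflexive v+suc-w≡M) M≤N))
                    (narrow-differs t t<v)))
    where M≤N = m≤m+n M (suc M)
          d≤N = ≤-trans (≤-reflexive d≡M) M≤N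

  start-orbit : IsICS (toSubP N start) × CycleLength rowmotion (toSubP N start) (suc (suc M))
  start-orbit =
    closed⇒IsICS (lagging ≤-refl (+-monoʳ-≤ v (s≤s (m≤n⇒m≤1+n (m≤m+n w v))))) ,
    cycle-length orbit (odd-orbit-closes w v)
                 (∉-orbit (m<m+n v z<s) v+suc-w≡M λ t t<v → inj₁ (>⇒≢ t<v)) orbit-length

  other-start-unreachable : ∀ w′ v′ → w′ + v′ ≡ w + v → w′ ≢ w →
                            ¬ Reaches rowmotion (toSubP N start) (toSubP N (OddStates.start w′ v′))
  other-start-unreachable w′ v′ same-sum w′≢w = cycle-¬reaches orbit (odd-orbit-closes w v) λ where
      (here eq) → toSubP-top-≢ (m<m+n v′ z<s) d′≤N (m<m+n v z<s) (≤-trans (≤-reflexive v+suc-w≡M) M≤N)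
                               (inj₁ λ where refl → w′≢w (+-cancelʳ-≡ v′ w′ w same-sum)) eq
      (there i) → ∉-orbit (m<m+n v′ z<s) d′≡M narrow-differs i
    where
    M≤N = m≤m+n M (suc M)
    d′≡M : v′ + suc w′ ≡ M
    d′≡M = trans (+-suc v′ w′) (cong suc (trans (+-comm v′ w′) same-sum))
    d′≤N = ≤-trans (≤-reflexive d′≡M) M≤N
    narrow-differs : ∀ t → t < v → v′ ≢ t ⊎ v′ + suc w′ ≢ t + suc w
    narrow-differs t _ with v′ ≟ t
    ... | yes refl = inj₂ λ e → w′≢w (suc-injective (+-cancelˡ-≡ v′ (suc w′) (suc w) e))
    ... | no v′≢t  = inj₁ v′≢t

oddStart : (m w : ℕ) → SubP (suc m + suc (suc m))
oddStart m w = toSubP (suc m + suc (suc m)) (OddStates.start w (m ∸ w))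

module _ (m : ℕ) where

  private
    N′ : ℕ → ℕ
    N′ m′ = suc m′ + suc (suc m′)

  oddStart-orbit : ∀ w → w ≤ m →
                   IsICS (oddStart m w) × CycleLength rowmotion (oddStart m w) (suc (suc (suc m)))
  oddStart-orbit w w≤m = transport (m+[n∸m]≡n w≤m)
    where
    transport : ∀ {m′} → w + (m ∸ w) ≡ m′ → let I = toSubP (N′ m′) (OddStates.start w (m ∸ w)) in
                IsICS I × CycleLength rowmotion I (suc (suc (suc m′)))
    transport refl = OddOrbit.start-orbit w (m ∸ w)

  oddStarts-apart : ∀ w w′ → w < w′ → w′ ≤ m → ¬ Reaches rowmotion (oddStart m w) (oddStart m w′)
  oddStarts-apart w w′ w<w′ w′≤m = transport (m+[n∸m]≡n (≤-trans (<⇒≤ w<w′) w′≤m))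
    where
    transport : ∀ {m′} → w + (m ∸ w) ≡ m′ →
                ¬ Reaches rowmotion (toSubP (N′ m′) (OddStates.start w (m ∸ w)))
                                    (toSubP (N′ m′) (OddStates.start w′ (m ∸ w′)))
    transport refl = OddOrbit.other-start-unreachable w (m ∸ w) w′ (m ∸ w′)
                       (trans (m+[n∸m]≡n w′≤m) (sym (m+[n∸m]≡n (≤-trans (<⇒≤ w<w′) w′≤m))))
                       (>⇒≢ w<w′)

  odd-orbits : AtLeastOrbits (suc m) (suc m + suc (suc m)) (suc (suc (suc m)))
  odd-orbits = atLeastOrbits (applyUpTo (oddStart m) (suc m))
                             (≤-reflexive (sym (length-applyUpTo (oddStart m) (suc m))))
    (All.applyUpTo⁺₁ (oddStart m) (suc m) λ w≤m → oddStart-orbit _ (≤-pred w≤m))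
    (AllPairs.applyUpTo⁺₁ (oddStart m) (suc m) λ w<w′ w′≤m → oddStarts-apart _ _ w<w′ (≤-pred w′≤m))

odd-split : ∀ n → ¬ 2 ∣ n → n ≡ suc (n / 2 * 2)
odd-split n ¬2∣n with n % 2 in r | m%n<n n 2
... | 0           | _ = contradiction (m%n≡0⇒n∣m n 2 r) ¬2∣n
... | 1           | _ = trans (m≡m%n+[m/n]*n n 2) (cong (_+ n / 2 * 2) r)
... | suc (suc _) | s≤s (s≤s ())

AtLeastOrbits-cong : ∀ {m m′ n n′ s s′} → m ≡ m′ → n ≡ n′ → s ≡ s′ →
                     AtLeastOrbits m n s → AtLeastOrbits m′ n′ s′
AtLeastOrbits-cong refl refl refl orbits = orbits

-- Below, the implicit arguments of AtLeastOrbits-cong are given explicitly: inferring them would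
-- compare two OrbitSize types and so unfold Row.
orbits-if-3∣ : ∀ n → 2 ≤ n → 3 ∣ n → AtLeastOrbits 1 n ((n + 3) / 3)
orbits-if-3∣ _ () (divides zero refl)
orbits-if-3∣ _ _  (divides (suc k) refl) =
  AtLeastOrbits-cong {n = N} {s = suc K} refl N≡n size≡ (single-orbit start-orbit)
  where
  open DivisibleByThree k
  N≡n : suc k + (suc k + suc k) ≡ suc k * 3
  N≡n = solve List.[ k ]
  n+3≡ : suc k * 3 + 3 ≡ suc (suc k) * 3
  n+3≡ = solve List.[ k ]
  size≡ : suc (suc k) ≡ (suc k * 3 + 3) / 3
  size≡ = sym (trans (cong (_/ 3) n+3≡) (m*n/n≡m (suc (suc k)) 3))

orbits-if-odd : ∀ n → 2 ≤ n → ¬ 2 ∣ n → AtLeastOrbits ((n ∸ 1) / 2) n ((n + 3) / 2)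
orbits-if-odd n 2≤n ¬2∣n = by-half (n / 2) (odd-split n ¬2∣n)
  where
  by-half : ∀ q → n ≡ suc (q * 2) → AtLeastOrbits ((n ∸ 1) / 2) n ((n + 3) / 2)
  by-half zero    n≡1 = contradiction (subst (2 ≤_) n≡1 2≤n) λ where (s≤s ())
  by-half (suc m) n≡ =
    AtLeastOrbits-cong {m = suc m} {n = suc m + suc (suc m)} {s = suc (suc (suc m))}
                       count≡ N≡n size≡ (odd-orbits m)
    where
    N≡2q+1 : suc m + suc (suc m) ≡ suc (suc m * 2)
    N≡2q+1 = solve List.[ m ]
    n+3≡ : suc (suc m * 2) + 3 ≡ suc (suc (suc m)) * 2
    n+3≡ = solve List.[ m ]
    N≡n : suc m + suc (suc m) ≡ n
    N≡n = trans N≡2q+1 (sym n≡)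
    count≡ : suc m ≡ (n ∸ 1) / 2
    count≡ = sym (trans (cong (λ x → (x ∸ 1) / 2) n≡) (m*n/n≡m (suc m) 2))
    size≡ : suc (suc (suc m)) ≡ (n + 3) / 2
    size≡ = sym (trans (cong (λ x → (x + 3) / 2) n≡)
                       (trans (cong (_/ 2) n+3≡) (m*n/n≡m (suc (suc (suc m))) 2)))

corollary3p9 : (n : ℕ) → 2 ≤ n →
    ((3 ∣ n) → AtLeastOrbits 1 n ((n + 3) / 3))
    × ((¬ (2 ∣ n)) → AtLeastOrbits ((n ∸ 1) / 2) n ((n + 3) / 2))
corollary3p9 n 2≤n = orbits-if-3∣ n 2≤n , orbits-if-odd n 2≤n
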